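{- Let $\Sigma$ be an alphabet, $\sigma:X\to\mathcal P(\Sigma^\star)$, and $\mathcal X\subseteq X$. Then there exist an alphabet $\Sigma'$, a map $\sigma':X\to\mathcal P(\Sigma'^\star)$ and a map $\lfloor\cdot\rfloor:\Sigma'^\star\to\Sigma^\star$ such that $\epsilon\notin\sigma'(a)$ for all $a\in\mathcal X$, and for every one-free expression $e$, $[\![e]\!]_\sigma=\lfloor [\![e]\!]_{\sigma'}\setminus\{\epsilon\}\rfloor$, where $\lfloor L\rfloor=\{\lfloor u\rfloor: u\in L\}$.
   Context: Fix a set $X$ of variables. One-free expressions are generated by $e,f::= x \mid 0\mid e+f\mid e\cdot f\mid e\cap f\mid e^+\mid \overline{e}$ ($x\in X$). Semantics: for an alphabet $\Sigma$ and $\sigma:X\to\mathcal P(\Sigma^\star)$, $[\![x]\!]_\sigma=\sigma(x)$, $[\![0]\!]_\sigma=\emptyset$, $+$ is union, $\cap$ intersection, $\cdot$ language concatenation, $e^+$ is $\bigcup_{n\ge1}[\![e]\!]_\sigma^n$, and $\overline e$ is the set of reversed (mirror) words of $[\![e]\!]_\sigma$. -}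

module Defs where

open import Data.List using (List; []; _++_; reverse)
open import Data.Nat using (ℕ; zero; suc)
open import Data.Product using (Σ; _×_; ∃; ∃-syntax)
open import Data.Sum using (_⊎_)
open import Relation.Binary.PropositionalEquality using (_≡_)
open import Relation.Nullary using (¬_)
open import Data.Empty using (⊥)

Lang : Set → Set₁
Lang A = List A → Set

module _ {A : Set} where

  ∅ : Lang A
  ∅ _ = ⊥

  _∪_ : Lang A → Lang A → Lang A
  (L ∪ M) w = L w ⊎ M w

  _∩_ : Lang A → Lang A → Lang A
  (L ∩ M) w = L w × M w

  _·_ : Lang A → Lang A → Lang A
  (L · M) w = ∃[ u ] ∃[ v ] (L u × M v × w ≡ u ++ v)

  -- pow L n = L^(n+1)
  pow : Lang A → ℕ → Lang A
  pow L zero = L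
  pow L (suc n) = L · pow L n

  _⁺ : Lang A → Lang A
  (L ⁺) w = ∃[ n ] pow L n w

  mirror : Lang A → Lang A
  mirror L w = ∃[ u ] (L u × w ≡ reverse u)

  nonEmpty : Lang A → Lang A
  nonEmpty L w = L w × ¬ (w ≡ [])

  _≐_ : Lang A → Lang A → Set
  L ≐ M = (∀ w → L w → M w) × (∀ w → M w → L w)

image : {A B : Set} → (List A → List B) → Lang A → Lang B
image f L w = ∃[ u ] (L u × w ≡ f u)

data Expr (X : Set) : Set where
  var  : X → Expr X
  zer  : Expr X
  _⊕_  : Expr X → Expr X → Expr X
  _⊗_  : Expr X → Expr X → Expr X
  _⊓_  : Expr X → Expr X → Expr X
  plus : Expr X → Expr X
  conv : Expr X → Expr X

⟦_⟧ : {X A : Set} → Expr X → (X → Lang A) → Lang A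
⟦ var x ⟧ σ = σ x
⟦ zer ⟧ σ = ∅
⟦ e ⊕ f ⟧ σ = ⟦ e ⟧ σ ∪ ⟦ f ⟧ σ
⟦ e ⊗ f ⟧ σ = ⟦ e ⟧ σ · ⟦ f ⟧ σ
⟦ e ⊓ f ⟧ σ = ⟦ e ⟧ σ ∩ ⟦ f ⟧ σ
⟦ plus e ⟧ σ = (⟦ e ⟧ σ) ⁺
⟦ conv e ⟧ σ = mirror (⟦ e ⟧ σ)

-- Add a fresh blank letter to the alphabet and let ⌊_⌋ delete blanks. A variable denotes the
-- nonempty words whose deletion lies in σ x; then no expression denotes ε, yet every word w
-- (ε included) is the deletion of the nonempty word blank ∷ w. Deletion commutes with
-- concatenation and mirror, which gives ⌊ ⟦ e ⟧ σ′ ⌋ ⊆ ⟦ e ⟧ σ. For the converse, intersection is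
-- the only obstacle: two preimages of the same word have a common padding, and every ⟦ e ⟧ σ′ is
-- closed under inserting blanks.
module Submission where

open import Defs
open import Data.List using (List; []; _∷_; _++_; _ʳ++_; reverse; map; catMaybes)
open import Data.List.Properties
  using (catMaybes-++; ++-conicalˡ; reverse-injective; reverse-involutive; ∷-injective)
open import Data.Maybe using (Maybe; just; nothing)
open import Data.Nat using (ℕ; zero; suc)
open import Data.Product using (Σ; _×_; ∃-syntax; _,_)
open import Data.Sum using (inj₁; inj₂)
open import Relation.Binary.PropositionalEquality using (_≡_; refl; sym; cong; subst)
open import Relation.Nullary using (¬_)
open import Function using (_∘_)
open import Relation.Unary using (_⊆_; _⊢_)

module _ {A : Set} where

  private variable
    K N : Lang A
    L M : Lang (Maybe A)
    u v u₁ u₂ v₁ v₂ : List (Maybe A)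

  ⌊_⌋ : List (Maybe A) → List A
  ⌊_⌋ = catMaybes

  ⌊⌋-ʳ++ : ∀ u v → ⌊ u ʳ++ v ⌋ ≡ ⌊ u ⌋ ʳ++ ⌊ v ⌋
  ⌊⌋-ʳ++ []            v = refl
  ⌊⌋-ʳ++ (just a ∷ u)  v = ⌊⌋-ʳ++ u (just a ∷ v)
  ⌊⌋-ʳ++ (nothing ∷ u) v = ⌊⌋-ʳ++ u (nothing ∷ v)

  ⌊⌋-reverse : ∀ u → ⌊ reverse u ⌋ ≡ reverse ⌊ u ⌋
  ⌊⌋-reverse u = ⌊⌋-ʳ++ u []

  ⌊⌋-map-just : ∀ w → ⌊ map just w ⌋ ≡ w
  ⌊⌋-map-just []      = refl
  ⌊⌋-map-just (a ∷ w) = cong (a ∷_) (⌊⌋-map-just w)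

  infix 4 _≼_
  data _≼_ : List (Maybe A) → List (Maybe A) → Set where
    []  : [] ≼ []
    _∷_ : ∀ c → u ≼ v → c ∷ u ≼ c ∷ v
    pad : u ≼ v → u ≼ nothing ∷ v

  ≼-++ : u₁ ≼ v₁ → u₂ ≼ v₂ → u₁ ++ u₂ ≼ v₁ ++ v₂
  ≼-++ []      q = q
  ≼-++ (c ∷ p) q = c ∷ ≼-++ p q
  ≼-++ (pad p) q = pad (≼-++ p q)

  ≼-ʳ++ : u₁ ≼ v₁ → u₂ ≼ v₂ → u₁ ʳ++ u₂ ≼ v₁ ʳ++ v₂
  ≼-ʳ++ []      q = q
  ≼-ʳ++ (c ∷ p) q = ≼-ʳ++ p (c ∷ q)
  ≼-ʳ++ (pad p) q = ≼-ʳ++ p (pad q)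

  ≼-reverse : u ≼ v → reverse u ≼ reverse v
  ≼-reverse p = ≼-ʳ++ p []

  ≼-++⁻ : ∀ u₁ u₂ → u₁ ++ u₂ ≼ v → ∃[ v₁ ] ∃[ v₂ ] (u₁ ≼ v₁ × u₂ ≼ v₂ × v ≡ v₁ ++ v₂)
  ≼-++⁻ []       u₂ p = [] , _ , [] , p , refl
  ≼-++⁻ (c ∷ u₁) u₂ (.c ∷ p) with ≼-++⁻ u₁ u₂ p
  ... | v₁ , v₂ , p₁ , p₂ , refl = c ∷ v₁ , v₂ , c ∷ p₁ , p₂ , refl
  ≼-++⁻ (c ∷ u₁) u₂ (pad p) with ≼-++⁻ (c ∷ u₁) u₂ p
  ... | v₁ , v₂ , p₁ , p₂ , refl = nothing ∷ v₁ , v₂ , pad p₁ , p₂ , refl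

  ≼-⌊⌋ : u ≼ v → ⌊ u ⌋ ≡ ⌊ v ⌋
  ≼-⌊⌋ []             = refl
  ≼-⌊⌋ (just a ∷ p)   = cong (a ∷_) (≼-⌊⌋ p)
  ≼-⌊⌋ (nothing ∷ p)  = ≼-⌊⌋ p
  ≼-⌊⌋ (pad p)        = ≼-⌊⌋ p

  ≼-nonEmpty : u ≼ v → ¬ u ≡ [] → ¬ v ≡ []
  ≼-nonEmpty []      u≢[] _  = u≢[] refl
  ≼-nonEmpty (_ ∷ _) _    ()
  ≼-nonEmpty (pad _) _    ()

  ≼-join : ∀ u₁ u₂ → ⌊ u₁ ⌋ ≡ ⌊ u₂ ⌋ → ∃[ v ] (u₁ ≼ v × u₂ ≼ v)
  ≼-join (nothing ∷ u₁) u₂ eq with ≼-join u₁ u₂ eq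
  ... | v , p₁ , p₂ = nothing ∷ v , nothing ∷ p₁ , pad p₂
  ≼-join u₁ (nothing ∷ u₂) eq with ≼-join u₁ u₂ eq
  ... | v , p₁ , p₂ = nothing ∷ v , pad p₁ , nothing ∷ p₂
  ≼-join [] [] _ = [] , [] , []
  ≼-join (just a ∷ u₁) (just b ∷ u₂) eq with ∷-injective eq
  ... | refl , eq′ with ≼-join u₁ u₂ eq′
  ... | v , p₁ , p₂ = just a ∷ v , just a ∷ p₁ , just a ∷ p₂

  Padded : Lang (Maybe A) → Set
  Padded L = ∀ {u v} → u ≼ v → L u → L v

  nonEmpty-⊢-padded : ∀ K → Padded (nonEmpty (⌊_⌋ ⊢ K))
  nonEmpty-⊢-padded K p (x , u≢[]) = subst K (≼-⌊⌋ p) x , ≼-nonEmpty p u≢[]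

  ∪-padded : Padded L → Padded M → Padded (L ∪ M)
  ∪-padded pL pM p (inj₁ x) = inj₁ (pL p x)
  ∪-padded pL pM p (inj₂ y) = inj₂ (pM p y)

  ∩-padded : Padded L → Padded M → Padded (L ∩ M)
  ∩-padded pL pM p (x , y) = pL p x , pM p y

  ·-padded : Padded L → Padded M → Padded (L · M)
  ·-padded pL pM p (u₁ , u₂ , x , y , refl) with ≼-++⁻ u₁ u₂ p
  ... | v₁ , v₂ , p₁ , p₂ , refl = v₁ , v₂ , pL p₁ x , pM p₂ y , refl

  pow-padded : Padded L → ∀ n → Padded (pow L n)
  pow-padded pL zero    = pL
  pow-padded pL (suc n) = ·-padded pL (pow-padded pL n)

  ⁺-padded : Padded L → Padded (L ⁺)
  ⁺-padded pL p (n , x) = n , pow-padded pL n p x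

  mirror-padded : Padded L → Padded (mirror L)
  mirror-padded pL {v = v} p (u , x , refl) =
    reverse v , pL (subst (_≼ reverse v) (reverse-involutive u) (≼-reverse p)) x ,
    sym (reverse-involutive v)

  εFree : Lang (Maybe A) → Set
  εFree L = ∀ {u} → L u → ¬ u ≡ []

  ∪-εFree : εFree L → εFree M → εFree (L ∪ M)
  ∪-εFree fL fM (inj₁ x) = fL x
  ∪-εFree fL fM (inj₂ y) = fM y

  ·-εFree : εFree L → εFree (L · M)
  ·-εFree fL (u₁ , u₂ , x , _ , refl) = fL x ∘ ++-conicalˡ u₁ u₂

  pow-εFree : εFree L → ∀ n → εFree (pow L n)
  pow-εFree fL zero    = fL
  pow-εFree fL (suc n) = ·-εFree fL

  ⁺-εFree : εFree L → εFree (L ⁺)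
  ⁺-εFree fL (n , x) = pow-εFree fL n x

  mirror-εFree : εFree L → εFree (mirror L)
  mirror-εFree fL (u , x , refl) = fL x ∘ reverse-injective

  image-∪-⊆ : image ⌊_⌋ L ⊆ K → image ⌊_⌋ M ⊆ N → image ⌊_⌋ (L ∪ M) ⊆ K ∪ N
  image-∪-⊆ sL sM (u , inj₁ x , refl) = inj₁ (sL (u , x , refl))
  image-∪-⊆ sL sM (u , inj₂ y , refl) = inj₂ (sM (u , y , refl))

  image-∩-⊆ : image ⌊_⌋ L ⊆ K → image ⌊_⌋ M ⊆ N → image ⌊_⌋ (L ∩ M) ⊆ K ∩ N
  image-∩-⊆ sL sM (u , (x , y) , refl) = sL (u , x , refl) , sM (u , y , refl)

  image-·-⊆ : image ⌊_⌋ L ⊆ K → image ⌊_⌋ M ⊆ N → image ⌊_⌋ (L · M) ⊆ K · N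
  image-·-⊆ sL sM (_ , (u₁ , u₂ , x , y , refl) , refl) =
    ⌊ u₁ ⌋ , ⌊ u₂ ⌋ , sL (u₁ , x , refl) , sM (u₂ , y , refl) , catMaybes-++ u₁ u₂

  image-pow-⊆ : image ⌊_⌋ L ⊆ K → ∀ n → image ⌊_⌋ (pow L n) ⊆ pow K n
  image-pow-⊆ sL zero    = sL
  image-pow-⊆ sL (suc n) = image-·-⊆ sL (image-pow-⊆ sL n)

  image-⁺-⊆ : image ⌊_⌋ L ⊆ K → image ⌊_⌋ (L ⁺) ⊆ K ⁺
  image-⁺-⊆ sL (u , (n , x) , refl) = n , image-pow-⊆ sL n (u , x , refl)

  image-mirror-⊆ : image ⌊_⌋ L ⊆ K → image ⌊_⌋ (mirror L) ⊆ mirror K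
  image-mirror-⊆ sL (_ , (u , x , refl) , refl) = ⌊ u ⌋ , sL (u , x , refl) , ⌊⌋-reverse u

  image-∪-⊇ : K ⊆ image ⌊_⌋ L → N ⊆ image ⌊_⌋ M → K ∪ N ⊆ image ⌊_⌋ (L ∪ M)
  image-∪-⊇ cK cN (inj₁ x) with cK x
  ... | u , x′ , eq = u , inj₁ x′ , eq
  image-∪-⊇ cK cN (inj₂ y) with cN y
  ... | u , y′ , eq = u , inj₂ y′ , eq

  image-∩-⊇ : Padded L → Padded M →
              K ⊆ image ⌊_⌋ L → N ⊆ image ⌊_⌋ M → K ∩ N ⊆ image ⌊_⌋ (L ∩ M)
  image-∩-⊇ pL pM cK cN (x , y) with cK x | cN y
  ... | u₁ , x′ , refl | u₂ , y′ , eq with ≼-join u₁ u₂ eq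
  ... | v , p₁ , p₂ = v , (pL p₁ x′ , pM p₂ y′) , ≼-⌊⌋ p₁

  image-·-⊇ : K ⊆ image ⌊_⌋ L → N ⊆ image ⌊_⌋ M → K · N ⊆ image ⌊_⌋ (L · M)
  image-·-⊇ cK cN (w₁ , w₂ , x , y , refl) with cK x | cN y
  ... | u₁ , x′ , refl | u₂ , y′ , refl =
    u₁ ++ u₂ , (u₁ , u₂ , x′ , y′ , refl) , sym (catMaybes-++ u₁ u₂)

  image-pow-⊇ : K ⊆ image ⌊_⌋ L → ∀ n → pow K n ⊆ image ⌊_⌋ (pow L n)
  image-pow-⊇ cK zero    = cK
  image-pow-⊇ cK (suc n) = image-·-⊇ cK (image-pow-⊇ cK n)

  image-⁺-⊇ : K ⊆ image ⌊_⌋ L → K ⁺ ⊆ image ⌊_⌋ (L ⁺)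
  image-⁺-⊇ cK (n , x) with image-pow-⊇ cK n x
  ... | u , x′ , eq = u , (n , x′) , eq

  image-mirror-⊇ : K ⊆ image ⌊_⌋ L → mirror K ⊆ image ⌊_⌋ (mirror L)
  image-mirror-⊇ cK (w , x , refl) with cK x
  ... | u , x′ , refl = reverse u , (u , x′ , refl) , sym (⌊⌋-reverse u)

module _ {X A : Set} (σ : X → Lang A) where

  σ′ : X → Lang (Maybe A)
  σ′ x = nonEmpty (⌊_⌋ ⊢ σ x)

  ⟦⟧-padded : ∀ e → Padded (⟦ e ⟧ σ′)
  ⟦⟧-padded (var x) = nonEmpty-⊢-padded (σ x)
  ⟦⟧-padded zer     = λ _ ()
  ⟦⟧-padded (e ⊕ f) = ∪-padded (⟦⟧-padded e) (⟦⟧-padded f)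
  ⟦⟧-padded (e ⊗ f) = ·-padded (⟦⟧-padded e) (⟦⟧-padded f)
  ⟦⟧-padded (e ⊓ f) = ∩-padded (⟦⟧-padded e) (⟦⟧-padded f)
  ⟦⟧-padded (plus e) = ⁺-padded (⟦⟧-padded e)
  ⟦⟧-padded (conv e) = mirror-padded (⟦⟧-padded e)

  ⟦⟧-εFree : ∀ e → εFree (⟦ e ⟧ σ′)
  ⟦⟧-εFree (var x) (_ , u≢[]) = u≢[]
  ⟦⟧-εFree zer     = λ ()
  ⟦⟧-εFree (e ⊕ f) = ∪-εFree (⟦⟧-εFree e) (⟦⟧-εFree f)
  ⟦⟧-εFree (e ⊗ f) = ·-εFree (⟦⟧-εFree e)
  ⟦⟧-εFree (e ⊓ f) (x , _) = ⟦⟧-εFree e x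
  ⟦⟧-εFree (plus e) = ⁺-εFree (⟦⟧-εFree e)
  ⟦⟧-εFree (conv e) = mirror-εFree (⟦⟧-εFree e)

  ⟦⟧-image-⊆ : ∀ e → image ⌊_⌋ (⟦ e ⟧ σ′) ⊆ ⟦ e ⟧ σ
  ⟦⟧-image-⊆ (var x) (_ , (x∈σ , _) , refl) = x∈σ
  ⟦⟧-image-⊆ zer     (_ , () , _)
  ⟦⟧-image-⊆ (e ⊕ f) = image-∪-⊆ (⟦⟧-image-⊆ e) (⟦⟧-image-⊆ f)
  ⟦⟧-image-⊆ (e ⊗ f) = image-·-⊆ (⟦⟧-image-⊆ e) (⟦⟧-image-⊆ f)
  ⟦⟧-image-⊆ (e ⊓ f) = image-∩-⊆ (⟦⟧-image-⊆ e) (⟦⟧-image-⊆ f)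
  ⟦⟧-image-⊆ (plus e) = image-⁺-⊆ (⟦⟧-image-⊆ e)
  ⟦⟧-image-⊆ (conv e) = image-mirror-⊆ (⟦⟧-image-⊆ e)

  ⟦⟧-image-⊇ : ∀ e → ⟦ e ⟧ σ ⊆ image ⌊_⌋ (⟦ e ⟧ σ′)
  ⟦⟧-image-⊇ (var x) {w} x∈σ =
    nothing ∷ map just w , (subst (σ x) (sym (⌊⌋-map-just w)) x∈σ , λ ()) , sym (⌊⌋-map-just w)
  ⟦⟧-image-⊇ zer     ()
  ⟦⟧-image-⊇ (e ⊕ f) = image-∪-⊇ (⟦⟧-image-⊇ e) (⟦⟧-image-⊇ f)
  ⟦⟧-image-⊇ (e ⊗ f) = image-·-⊇ (⟦⟧-image-⊇ e) (⟦⟧-image-⊇ f)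
  ⟦⟧-image-⊇ (e ⊓ f) = image-∩-⊇ (⟦⟧-padded e) (⟦⟧-padded f) (⟦⟧-image-⊇ e) (⟦⟧-image-⊇ f)
  ⟦⟧-image-⊇ (plus e) = image-⁺-⊇ (⟦⟧-image-⊇ e)
  ⟦⟧-image-⊇ (conv e) = image-mirror-⊇ (⟦⟧-image-⊇ e)

proposition4 : (X Sig : Set) (σ : X → Lang Sig) (𝒳 : X → Set) →
    Σ Set λ Sig' → Σ (X → Lang Sig') λ σ' → Σ (List Sig' → List Sig) λ fl →
      (∀ a → 𝒳 a → ¬ σ' a []) ×
      (∀ (e : Expr X) → ⟦ e ⟧ σ ≐ image fl (nonEmpty (⟦ e ⟧ σ')))
proposition4 X Sig σ 𝒳 =
  Maybe Sig , σ′ σ , ⌊_⌋ , (λ a _ x → ⟦⟧-εFree σ (var a) x refl) , λ e → into e , out e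
  where
    into : ∀ e w → ⟦ e ⟧ σ w → image ⌊_⌋ (nonEmpty (⟦ e ⟧ (σ′ σ))) w
    into e w x with ⟦⟧-image-⊇ σ e x
    ... | u , x′ , eq = u , (x′ , ⟦⟧-εFree σ e x′) , eq

    out : ∀ e w → image ⌊_⌋ (nonEmpty (⟦ e ⟧ (σ′ σ))) w → ⟦ e ⟧ σ w
    out e w (u , (x , _) , refl) = ⟦⟧-image-⊆ σ e (u , x , refl)
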